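{- The following rule set for graded modal logic is not one-step complete. Concretely, let $X=\{a,b,c,d\}$, take propositional variables $p_A$ for all $A\subseteq X$, and let $\tau$ be the valuation $\tau(p_A)=A$. Let $\chi$ be the one-step clause whose conjuncts are the positive literals $\langle 2\rangle p_A$ for all $A\subseteq X$ with $|A|=2$, together with the negative literal $\neg\langle 6\rangle p_X$. Then: (i) $\chi$ is not satisfiable over $\tau$, i.e. there is no finite multiset $\mu\colon X\to\mathbb{N}$ satisfying $\chi$; (ii) every rule instance matching $\chi$ has a conclusion that is satisfiable over $\tau$. Consequently, there exist a finite set $X$, a valuation $\tau$ and a one-step clause $\chi$ such that all rule instances matching $\chi$ have conclusions satisfiable over $\tau$, while $\chi$ itself is unsatisfiable over $\tau$.
   Context: Graded modal one-step logic. A valuation over a set $X$ assigns to each propositional variable a subset of $X$. A finite multiset over $X$ is a map $\mu\colon X\to\mathbb{N}$; write $\mu(A)=\sum_{x\in A}\mu(x)$ for $A\subseteq X$. A modal literal is a formula $\langle n\rangle a$ or $\neg\langle n\rangle a$ with $n\in\mathbb{N}$ and $a$ a propositional variable. A one-step clause is a finite conjunction of modal literals. Given $X,\tau$, a multiset $\mu$ over $X$ satisfies $\langle n\rangle a$ iff $\mu(\tau(a))>n$, satisfies $\neg\langle n\rangle a$ iff $\mu(\tau(a))\le n$, and satisfies a conjunction iff it satisfies every conjunct. A one-step clause is satisfiable over $\tau$ if some finite multiset $\mu$ over $X$ satisfies it. The rule set: for $u,v\ge 0$, an instance consists of literals $\langle n_1\rangle p_1,\dots,\langle n_u\rangle p_u$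 and $\neg\langle m_1\rangle q_1,\dots,\neg\langle m_v\rangle q_v$ (premiss) and coefficients $r_1,\dots,r_u,s_1,\dots,s_v\in\mathbb{N}\setminus\{0\}$ subject to the side condition $\sum_{i=1}^u r_i(n_i+1)-\sum_{i=1}^v s_i m_i\ge 1$; its conclusion is the propositional constraint $\sum_{i=1}^u r_i p_i-\sum_{i=1}^v s_i q_i>0$, read as a Boolean function of the variables (true $=1$, false $=0$). An instance matches a one-step clause $\chi$ if every literal of its premiss is a conjunct of $\chi$. The conclusion is interpreted over $\tau$ as the set of $x\in X$ with $\sum_{i} r_i[x\in\tau(p_i)]-\sum_j s_j[x\in\tau(q_j)]>0$ (where $[\cdot]\in\{0,1\}$), and is satisfiable over $\tau$ if this set is nonempty. The rule set is one-step complete if for every finite $X$, valuation $\tau$ and one-step clause $\chi$: whenever all rule instances matching $\chi$ have conclusions satisfiable over $\tau$, $\chi$ is satisfiable over $\tau$. -}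

module Defs where

open import Data.Nat using (ℕ; zero; suc; _+_; _*_; _≤_; _<_; _>_)
open import Data.Bool using (Bool; true; false; if_then_else_)
open import Data.Fin using (Fin; zero; suc)
open import Data.Fin.Subset using (Subset)
open import Data.Vec using (Vec; []; _∷_; lookup)
open import Data.List using (List; []; _∷_; map; allFin)
open import Data.Nat.ListAction using (sum)
open import Data.List.Membership.Propositional using (_∈_)
open import Data.List.Relation.Unary.All using (All)
open import Data.Product using (Σ; ∃; _×_; _,_)
open import Relation.Nullary using (¬_)

-- Generic one-step semantics.
-- X is represented as Fin k (a finite set), propositional variables
-- range over an arbitrary type V, a valuation is τ : V → Subset k.

[_∈_] : ∀ {k} → Fin k → Subset k → ℕ
[ x ∈ A ] = if lookup A x then 1 else 0

Multiset : ℕ → Set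
Multiset k = Fin k → ℕ

measure : ∀ {k} → Multiset k → Subset k → ℕ
measure {k} μ A = sum (map (λ x → if lookup A x then μ x else 0) (allFin k))

data Literal (V : Set) : Set where
  pos : ℕ → V → Literal V
  neg : ℕ → V → Literal V

Clause : Set → Set
Clause V = List (Literal V)

_,_⊨lit_ : ∀ {V k} → (V → Subset k) → Multiset k → Literal V → Set
τ , μ ⊨lit pos n a = measure μ (τ a) > n
τ , μ ⊨lit neg n a = measure μ (τ a) ≤ n

_,_⊨_ : ∀ {V k} → (V → Subset k) → Multiset k → Clause V → Set
τ , μ ⊨ χ = All (τ , μ ⊨lit_) χ

SatClause : ∀ {V k} → (V → Subset k) → Clause V → Set
SatClause {k = k} τ χ = Σ (Multiset k) λ μ → τ , μ ⊨ χ

-- Rule instances.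
-- A positive premiss entry (r , n , p) stands for literal ⟨n⟩p with
-- coefficient r; a negative entry (s , m , q) for ¬⟨m⟩q with coefficient s.

record RuleInstance (V : Set) : Set where
  field
    posPrem : List (ℕ × ℕ × V)
    negPrem : List (ℕ × ℕ × V)
    posCoeffNonzero : All (λ { (r , _ , _) → 1 ≤ r }) posPrem
    negCoeffNonzero : All (λ { (s , _ , _) → 1 ≤ s }) negPrem
    sideCondition :
      1 + sum (map (λ { (s , m , _) → s * m }) negPrem)
        ≤ sum (map (λ { (r , n , _) → r * suc n }) posPrem)
open RuleInstance public

Matches : ∀ {V} → RuleInstance V → Clause V → Set
Matches R χ =
  All (λ { (_ , n , p) → pos n p ∈ χ }) (posPrem R) ×
  All (λ { (_ , m , q) → neg m q ∈ χ }) (negPrem R)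

-- x belongs to the interpretation of the conclusion Σ r_i p_i - Σ s_j q_j > 0
InConclusion : ∀ {V k} → (V → Subset k) → RuleInstance V → Fin k → Set
InConclusion τ R x =
  sum (map (λ { (s , _ , q) → s * [ x ∈ τ q ] }) (negPrem R))
    < sum (map (λ { (r , _ , p) → r * [ x ∈ τ p ] }) (posPrem R))

ConclusionSat : ∀ {V k} → (V → Subset k) → RuleInstance V → Set
ConclusionSat {k = k} τ R = Σ (Fin k) λ x → InConclusion τ R x

OneStepComplete : Set → Set
OneStepComplete V =
  ∀ (k : ℕ) (τ : V → Subset k) (χ : Clause V) →
  (∀ (R : RuleInstance V) → Matches R χ → ConclusionSat τ R) →
  SatClause τ χ

-- The concrete counterexample: X = {a,b,c,d} = Fin 4,
-- variables p_A for A ⊆ X (so V = Subset 4), τ(p_A) = A.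

τ₀ : Subset 4 → Subset 4
τ₀ A = A

Aab Aac Aad Abc Abd Acd Xall : Subset 4
Aab = true  ∷ true  ∷ false ∷ false ∷ []
Aac = true  ∷ false ∷ true  ∷ false ∷ []
Aad = true  ∷ false ∷ false ∷ true  ∷ []
Abc = false ∷ true  ∷ true  ∷ false ∷ []
Abd = false ∷ true  ∷ false ∷ true  ∷ []
Acd = false ∷ false ∷ true  ∷ true  ∷ []
Xall = true ∷ true  ∷ true  ∷ true  ∷ []

χ₀ : Clause (Subset 4)
χ₀ = pos 2 Aab ∷ pos 2 Aac ∷ pos 2 Aad ∷ pos 2 Abc ∷ pos 2 Abd ∷ pos 2 Acd
   ∷ neg 6 Xall ∷ []

-- A rule instance is sound not only for integral multisets but for every
-- rational one μ/d, provided ⟨n⟩a is read as μ(a) ≥ n + 1: weighting the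
-- conclusion at each point x by μ(x) and summing gives
-- Σ r_i μ(p_i) − Σ s_j μ(q_j) ≥ d (Σ r_i (n_i + 1) − Σ s_j m_j) > 0, so the
-- conclusion holds at some point.  The constant multiset 3/2 is such a model
-- of χ₀, yet χ₀ has no integral model: all three splittings of X into two
-- pairs would have to be tight, forcing μ(a) = μ(b) = μ(c) = 3/2.
module Submission where

open import Defs
open import Data.Product using (_×_)
open import Relation.Nullary using (¬_)
open import Data.Fin.Subset using (Subset)

open import Data.Bool using (true; false; if_then_else_)
open import Data.Fin using (Fin; zero; suc)
open import Data.List using (List; []; _∷_; map; allFin)
open import Data.List.Membership.Propositional using (_∈_)
open import Data.List.Relation.Unary.All using (All; []; _∷_)
import Data.List.Relation.Unary.All as All
open import Data.List.Properties using (map-cong)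
open import Data.Nat
open import Data.Nat.ListAction using (sum)
open import Data.Nat.Properties
open import Data.Nat.Tactic.RingSolver using (solve-∀)
open import Data.Product using (∃; _,_)
open import Data.Vec using (lookup)
open import Relation.Binary.PropositionalEquality hiding ([_])
open import Relation.Nullary using (yes; no)
open import Algebra.Properties.CommutativeSemigroup +-commutativeSemigroup
  using () renaming (interchange to +-interchange)

d*[r*a+b]≡r*[d*a]+d*b : ∀ d r a b → d * (r * a + b) ≡ r * (d * a) + d * b
d*[r*a+b]≡r*[d*a]+d*b = solve-∀

module _ {A : Set} where

  sum-map-+ : ∀ (f g : A → ℕ) xs →
              sum (map (λ x → f x + g x) xs) ≡ sum (map f xs) + sum (map g xs)
  sum-map-+ f g []       = refl
  sum-map-+ f g (x ∷ xs) =
    trans (cong (f x + g x +_) (sum-map-+ f g xs)) (+-interchange (f x) (g x) _ _)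

  sum-map-*ˡ : ∀ c (f : A → ℕ) xs → sum (map (λ x → c * f x) xs) ≡ c * sum (map f xs)
  sum-map-*ˡ c f []       = sym (*-zeroʳ c)
  sum-map-*ˡ c f (x ∷ xs) =
    trans (cong (c * f x +_) (sum-map-*ˡ c f xs)) (sym (*-distribˡ-+ c (f x) _))

  sum-map-<⇒∃< : ∀ (f g : A → ℕ) xs → sum (map f xs) < sum (map g xs) → ∃ λ x → f x < g x
  sum-map-<⇒∃< f g []       ()
  sum-map-<⇒∃< f g (x ∷ xs) Σf<Σg with f x <? g x
  ... | yes fx<gx = x , fx<gx
  ... | no  fx≮gx = sum-map-<⇒∃< f g xs (≰⇒> λ Σg≤Σf →
                        <⇒≱ Σf<Σg (+-mono-≤ (≮⇒≥ fx≮gx) Σg≤Σf))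

module _ {V : Set} {k : ℕ} (τ : V → Subset k) where

  weight : List (ℕ × ℕ × V) → Fin k → ℕ
  weight L x = sum (map (λ { (s , _ , q) → s * [ x ∈ τ q ] }) L)

  measure≡Σ[∈]*μ : ∀ (μ : Multiset k) A → measure μ A ≡ sum (map (λ x → [ x ∈ A ] * μ x) (allFin k))
  measure≡Σ[∈]*μ μ A = cong sum (map-cong pointwise (allFin k))
    where
    pointwise : ∀ x → (if lookup A x then μ x else 0) ≡ [ x ∈ A ] * μ x
    pointwise x with lookup A x
    ... | true  = sym (+-identityʳ (μ x))
    ... | false = refl

  Σs*measure : Multiset k → List (ℕ × ℕ × V) → ℕ
  Σs*measure μ L = sum (map (λ { (s , _ , q) → s * measure μ (τ q) }) L)

  Σweight*μ≡Σs*measure : ∀ (μ : Multiset k) L →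
    sum (map (λ x → weight L x * μ x) (allFin k)) ≡ Σs*measure μ L
  Σweight*μ≡Σs*measure μ [] = sum-map-*ˡ 0 μ (allFin k)
  Σweight*μ≡Σs*measure μ ((s , _ , q) ∷ L) = begin
    sum (map (λ x → (s * [ x ∈ τ q ] + weight L x) * μ x) (allFin k))
      ≡⟨ cong sum (map-cong (λ x → distribute s [ x ∈ τ q ] (weight L x) (μ x)) (allFin k)) ⟩
    sum (map (λ x → s * ([ x ∈ τ q ] * μ x) + weight L x * μ x) (allFin k))
      ≡⟨ sum-map-+ _ _ (allFin k) ⟩
    sum (map (λ x → s * ([ x ∈ τ q ] * μ x)) (allFin k)) + sum (map (λ x → weight L x * μ x) (allFin k))
      ≡⟨ cong₂ _+_ (sum-map-*ˡ s _ (allFin k)) (Σweight*μ≡Σs*measure μ L) ⟩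
    s * sum (map (λ x → [ x ∈ τ q ] * μ x) (allFin k)) + Σs*measure μ L
      ≡⟨ cong (λ m → s * m + Σs*measure μ L) (measure≡Σ[∈]*μ μ (τ q)) ⟨
    s * measure μ (τ q) + Σs*measure μ L ∎
    where
    open ≡-Reasoning
    distribute : ∀ s b w m → (s * b + w) * m ≡ s * (b * m) + w * m
    distribute = solve-∀

  -- μ / d is a rational multiset satisfying the literal, with ⟨n⟩a
  -- strengthened to μ(a) ≥ n + 1 as it is automatically for integral multisets.
  FractionallySatisfies : Multiset k → ℕ → Literal V → Set
  FractionallySatisfies μ d (pos n p) = d * suc n ≤ measure μ (τ p)
  FractionallySatisfies μ d (neg m q) = measure μ (τ q) ≤ d * m

  FractionalModel : Clause V → Multiset k → ℕ → Set
  FractionalModel χ μ d = All (FractionallySatisfies μ d) χ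

  module _ {χ : Clause V} {μ : Multiset k} {d : ℕ} (model : FractionalModel χ μ d) where

    d*Σr*[n+1]≤Σr*measure : ∀ {L} → All (λ { (_ , n , p) → pos n p ∈ χ }) L →
      d * sum (map (λ { (r , n , _) → r * suc n }) L) ≤ Σs*measure μ L
    d*Σr*[n+1]≤Σr*measure []                          = ≤-reflexive (*-zeroʳ d)
    d*Σr*[n+1]≤Σr*measure {(r , n , p) ∷ L} (p∈χ ∷ ps) = begin
      d * (r * suc n + sum (map (λ { (r , n , _) → r * suc n }) L))
        ≡⟨ d*[r*a+b]≡r*[d*a]+d*b d r (suc n) _ ⟩
      r * (d * suc n) + d * sum (map (λ { (r , n , _) → r * suc n }) L)
        ≤⟨ +-mono-≤ (*-monoʳ-≤ r (All.lookup model p∈χ)) (d*Σr*[n+1]≤Σr*measure ps) ⟩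
      r * measure μ (τ p) + Σs*measure μ L ∎
      where open ≤-Reasoning

    Σs*measure≤d*Σs*m : ∀ {L} → All (λ { (_ , m , q) → neg m q ∈ χ }) L →
      Σs*measure μ L ≤ d * sum (map (λ { (s , m , _) → s * m }) L)
    Σs*measure≤d*Σs*m []                          = ≤-reflexive (sym (*-zeroʳ d))
    Σs*measure≤d*Σs*m {(s , m , q) ∷ L} (q∈χ ∷ qs) = begin
      s * measure μ (τ q) + Σs*measure μ L
        ≤⟨ +-mono-≤ (*-monoʳ-≤ s (All.lookup model q∈χ)) (Σs*measure≤d*Σs*m qs) ⟩
      s * (d * m) + d * sum (map (λ { (s , m , _) → s * m }) L)
        ≡⟨ d*[r*a+b]≡r*[d*a]+d*b d s m _ ⟨
      d * (s * m + sum (map (λ { (s , m , _) → s * m }) L)) ∎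
      where open ≤-Reasoning

    Σneg-weight*μ<Σpos-weight*μ : .{{NonZero d}} → ∀ (R : RuleInstance V) → Matches R χ →
      sum (map (λ x → weight (negPrem R) x * μ x) (allFin k)) <
      sum (map (λ x → weight (posPrem R) x * μ x) (allFin k))
    Σneg-weight*μ<Σpos-weight*μ R (P⊆χ , N⊆χ) = begin-strict
      sum (map (λ x → weight (negPrem R) x * μ x) (allFin k))
        ≡⟨ Σweight*μ≡Σs*measure μ (negPrem R) ⟩
      Σs*measure μ (negPrem R)
        ≤⟨ Σs*measure≤d*Σs*m N⊆χ ⟩
      d * sum (map (λ { (s , m , _) → s * m }) (negPrem R))
        <⟨ *-monoʳ-< d (sideCondition R) ⟩
      d * sum (map (λ { (r , n , _) → r * suc n }) (posPrem R))
        ≤⟨ d*Σr*[n+1]≤Σr*measure P⊆χ ⟩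
      Σs*measure μ (posPrem R)
        ≡⟨ Σweight*μ≡Σs*measure μ (posPrem R) ⟨
      sum (map (λ x → weight (posPrem R) x * μ x) (allFin k)) ∎
      where open ≤-Reasoning

    fractionalModel⇒conclusionSat : .{{NonZero d}} →
      ∀ (R : RuleInstance V) → Matches R χ → ConclusionSat τ R
    fractionalModel⇒conclusionSat R matches =
      let x , weight⁻*μ<weight⁺*μ = sum-map-<⇒∃< _ _ (allFin k) (Σneg-weight*μ<Σpos-weight*μ R matches)
      in  x , *-cancelʳ-< (μ x) _ _ weight⁻*μ<weight⁺*μ

complementaryPair-tight : ∀ {t p q} → t ≤ p → t ≤ q → p + q ≤ t + t → p ≡ t
complementaryPair-tight {t} {p} t≤p t≤q p+q≤t+t =
  ≤-antisym (+-cancelʳ-≤ t p t (≤-trans (+-monoʳ-≤ p t≤q) p+q≤t+t)) t≤p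

pairSums-tight⇒b+b≡t : ∀ {t a b c d} →
  t ≤ a + b → t ≤ a + c → t ≤ a + d → t ≤ b + c → t ≤ b + d → t ≤ c + d →
  a + (b + (c + d)) ≤ t + t → b + b ≡ t
pairSums-tight⇒b+b≡t {t} {a} {b} {c} {d} ab ac ad bc bd cd total =
  trans (cong (b +_) b≡c) b+c≡t
  where
  splitting : ∀ p q → p + q ≡ a + (b + (c + d)) → p + q ≤ t + t
  splitting _ _ eq = subst (_≤ t + t) (sym eq) total
  ac+bd : ∀ a b c d → a + c + (b + d) ≡ a + (b + (c + d))
  ac+bd = solve-∀
  bc+ad : ∀ a b c d → b + c + (a + d) ≡ a + (b + (c + d))
  bc+ad = solve-∀
  a+b≡t : a + b ≡ t
  a+b≡t = complementaryPair-tight ab cd (splitting (a + b) (c + d) (+-assoc a b (c + d)))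
  a+c≡t : a + c ≡ t
  a+c≡t = complementaryPair-tight ac bd (splitting (a + c) (b + d) (ac+bd a b c d))
  b+c≡t : b + c ≡ t
  b+c≡t = complementaryPair-tight bc ad (splitting (b + c) (a + d) (bc+ad a b c d))
  b≡c : b ≡ c
  b≡c = +-cancelˡ-≡ a b c (trans a+b≡t (sym a+c≡t))

b+b≢3 : ∀ b → b + b ≢ 3
b+b≢3 0 ()
b+b≢3 1 ()
b+b≢3 (suc (suc b)) b+b≡3 = n≮n 3 (subst (4 ≤_) b+b≡3 (+-mono-≤ (m≤m+n 2 b) (m≤m+n 2 b)))

χ₀-unsatisfiable : ¬ SatClause τ₀ χ₀
χ₀-unsatisfiable (μ , ab ∷ ac ∷ ad ∷ bc ∷ bd ∷ cd ∷ total ∷ []) =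
  b+b≢3 b (pairSums-tight⇒b+b≡t {3} {a} {b} {c} {d}
            (pair a b ab) (pair a c ac) (pair a d ad) (pair b c bc) (pair b d bd) (pair c d cd)
            (subst (_≤ 6) (cong (λ z → a + (b + (c + z))) (+-identityʳ d)) total))
  where
  a b c d : ℕ
  a = μ zero
  b = μ (suc zero)
  c = μ (suc (suc zero))
  d = μ (suc (suc (suc zero)))
  pair : ∀ x y → 3 ≤ x + (y + 0) → 3 ≤ x + y
  pair x y = subst (3 ≤_) (cong (x +_) (+-identityʳ y))

χ₀-fractionalModel : FractionalModel τ₀ χ₀ (λ _ → 3) 2
χ₀-fractionalModel = ≤-refl ∷ ≤-refl ∷ ≤-refl ∷ ≤-refl ∷ ≤-refl ∷ ≤-refl ∷ ≤-refl ∷ []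

mainTheorem1 : (¬ SatClause τ₀ χ₀)
    × (∀ (R : RuleInstance (Subset 4)) → Matches R χ₀ → ConclusionSat τ₀ R)
    × (¬ OneStepComplete (Subset 4))
mainTheorem1 =
  χ₀-unsatisfiable , conclusionsSat ,
  λ complete → χ₀-unsatisfiable (complete 4 τ₀ χ₀ conclusionsSat)
  where
  conclusionsSat : ∀ (R : RuleInstance (Subset 4)) → Matches R χ₀ → ConclusionSat τ₀ R
  conclusionsSat = fractionalModel⇒conclusionSat τ₀ χ₀-fractionalModel
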